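{- Let $G$ be a cross-free finite simple bipartite graph with at least two vertices. Then for any pure order $\{x_1,\ldots,x_n\}$, $\{y_1,\ldots,y_n\}$ of $G$ there exist $i,j$ such that $x_i$ and $y_j$ both have degree one in $G$.
   Context: A pure order of $G$ is a partition of the vertex set into independent sets $\{x_1,\ldots,x_n\}$, $\{y_1,\ldots,y_n\}$ such that $x_iy_i$ is an edge for all $i$, and whenever $x_iy_j$ and $x_jy_k$ are edges with $i,j,k$ distinct, $x_iy_k$ is an edge. A pure order has a cross if for some $i\neq j$ both $x_iy_j$ and $x_jy_i$ are edges. $G$ is cross-free if it has a pure order and none of its pure orders has a cross (equivalently, it has a pure order without a cross). -}

module Defs where

open import Data.Nat using (ℕ)
open import Data.Fin using (Fin)
open import Data.List using (List; length; filter)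
open import Data.Bool using (Bool)
open import Data.Sum using (_⊎_; [_,_])
open import Data.Product using (Σ; ∃; _×_; _,_)
open import Relation.Nullary using (¬_)
open import Relation.Binary using (Rel; Decidable)
open import Relation.Binary.PropositionalEquality using (_≡_; _≢_)
open import Function.Definitions using (Bijective)
open import Level using (0ℓ)

open import Data.List.Base using () renaming (allFin to allFinL)

record SimpleGraph (m : ℕ) : Set₁ where
  field
    Adj    : Rel (Fin m) 0ℓ
    adj?   : Decidable Adj
    sym    : ∀ {u v} → Adj u v → Adj v u
    irrefl : ∀ {v} → ¬ Adj v v

open SimpleGraph public

degree : ∀ {m} → SimpleGraph m → Fin m → ℕ
degree {m} G v = length (filter (adj? G v) (allFinL m))

IsBipartite : ∀ {m} → SimpleGraph m → Set
IsBipartite {m} G = Σ (Fin m → Bool) λ c → ∀ u v → Adj G u v → c u ≢ c v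

-- A pure order: X = {x_1..x_n}, Y = {y_1..y_n} partitioning the vertex set
-- (the combined map Fin n ⊎ Fin n → Fin m is a bijection), both independent,
-- x_i y_i edges, and the transitivity condition for distinct i, j, k.
record PureOrder {m : ℕ} (G : SimpleGraph m) : Set where
  field
    n          : ℕ
    x          : Fin n → Fin m
    y          : Fin n → Fin m
    partition  : Bijective _≡_ _≡_ [ x , y ]
    indepX     : ∀ i j → ¬ Adj G (x i) (x j)
    indepY     : ∀ i j → ¬ Adj G (y i) (y j)
    matched    : ∀ i → Adj G (x i) (y i)
    transitive : ∀ i j k → i ≢ j → j ≢ k → i ≢ k →
                 Adj G (x i) (y j) → Adj G (x j) (y k) → Adj G (x i) (y k)

open PureOrder public

HasCross : ∀ {m} {G : SimpleGraph m} → PureOrder G → Set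
HasCross {G = G} P = ∃ λ i → ∃ λ j → i ≢ j × Adj G (x P i) (y P j) × Adj G (x P j) (y P i)

CrossFree : ∀ {m} → SimpleGraph m → Set
CrossFree G = PureOrder G × (∀ (P : PureOrder G) → ¬ HasCross P)

module Submission where

-- For a pure order x₁…xₙ, y₁…yₙ write  i ≺ j  when i ≠ j and
-- xᵢyⱼ is an edge.  The transitivity axiom of a pure order makes ≺
-- transitive except when it would close a 2-cycle i ≺ j ≺ i, and such a
-- 2-cycle is precisely a cross; so for a cross-free graph ≺ is a strict
-- partial order on the finite index set, and the index set is nonempty as
-- soon as G has a vertex.  Take i ≺-maximal and j ≺-minimal.  Since X and Y
-- are independent and cover all vertices, every neighbour of xᵢ is some yₖ,
-- and maximality forces k = i; so xᵢ has the single neighbour yᵢ.  Dually yⱼ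
-- has the single neighbour xⱼ.

open import Defs
open import Data.Nat using (ℕ; _≤_; suc; s≤s)
open import Data.Fin using (Fin; zero; suc; _≟_)
open import Data.Fin.Properties using (0≢1+n; suc-injective)
open import Data.List using (List; []; _∷_; length; filter; tabulate; allFin)
open import Data.List.Properties using (filter-accept; filter-reject; filter-none)
open import Data.List.Relation.Unary.All.Properties using (tabulate⁺)
open import Data.List.Relation.Unary.Any using (here; there)
open import Data.List.Membership.Propositional using (_∈_)
open import Data.List.Membership.Propositional.Properties using (∈-allFin)
open import Data.Sum using (inj₁; inj₂)
open import Data.Product using (Σ; ∃; _×_; _,_; proj₁; proj₂)
open import Function using (_∘_)
open import Relation.Nullary using (¬_; yes; no; Dec; contradiction)
open import Relation.Unary using (Pred; Decidable)
open import Relation.Binary using (Rel)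
open import Relation.Binary.PropositionalEquality
  using (_≡_; _≢_; refl; cong; module ≡-Reasoning)
  renaming (sym to ≡-sym)
open import Level using (0ℓ)

count-unique : ∀ {A : Set} {P : Pred A 0ℓ} (P? : Decidable P) {n} (f : Fin n → A)
               (i₀ : Fin n) → P (f i₀) → (∀ i → P (f i) → i ≡ i₀) →
               length (filter P? (tabulate f)) ≡ 1
count-unique P? f zero p only = begin
    length (filter P? (tabulate f))
  ≡⟨ cong length (filter-accept P? p) ⟩
    suc (length (filter P? (tabulate (f ∘ suc))))
  ≡⟨ cong (suc ∘ length) (filter-none P? (tabulate⁺ (λ i → 0≢1+n ∘ ≡-sym ∘ only (suc i)))) ⟩
    1
  ∎
  where open ≡-Reasoning
count-unique P? f (suc i₀) p only = begin
    length (filter P? (tabulate f))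
  ≡⟨ cong length (filter-reject P? (0≢1+n ∘ only zero)) ⟩
    length (filter P? (tabulate (f ∘ suc)))
  ≡⟨ count-unique P? (f ∘ suc) i₀ p (λ i → suc-injective ∘ only (suc i)) ⟩
    1
  ∎
  where open ≡-Reasoning

degree-one : ∀ {m} (G : SimpleGraph m) {v w : Fin m} →
             Adj G v w → (∀ u → Adj G v u → u ≡ w) → degree G v ≡ 1
degree-one G {v} {w} vw only = count-unique (adj? G v) (λ u → u) w vw only

module MaximalElement {A : Set} (_<_ : Rel A 0ℓ) (_<?_ : ∀ a b → Dec (a < b))
                      (irrefl : ∀ a → ¬ a < a)
                      (trans : ∀ {a b c} → a < b → b < c → a < c) where

  Dominates : A → A → Set
  Dominates c′ c = ∀ k → c′ < k → c < k

  maximal-in : (xs : List A) (c : A) →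
               Σ A λ c′ → Dominates c′ c × (∀ k → k ∈ xs → ¬ c′ < k)
  maximal-in [] c = c , (λ _ c<k → c<k) , λ _ ()
  maximal-in (y ∷ ys) c with c <? y
  ... | yes c<y =
    let (c′ , dom , max) = maximal-in ys y
    in c′ , (λ k → trans c<y ∘ dom k)
          , λ { k (here refl) → irrefl k ∘ dom k ; k (there k∈ys) → max k k∈ys }
  ... | no c≮y =
    let (c′ , dom , max) = maximal-in ys c
    in c′ , dom
          , λ { k (here refl) → c≮y ∘ dom k ; k (there k∈ys) → max k k∈ys }

  maximal : (xs : List A) → (∀ a → a ∈ xs) → A → Σ A λ c → ∀ k → ¬ c < k
  maximal xs covers a₀ =
    let (c , _ , max) = maximal-in xs a₀ in c , λ k → max k (covers k)

module CrossFreeOrder {m} (G : SimpleGraph m) (P : PureOrder G) (noCross : ¬ HasCross P) where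

  _≺_ : Rel (Fin (n P)) 0ℓ
  i ≺ j = i ≢ j × Adj G (x P i) (y P j)

  _≺?_ : ∀ i j → Dec (i ≺ j)
  i ≺? j with i ≟ j | adj? G (x P i) (y P j)
  ... | yes i≡j | _       = no (λ i≺j → proj₁ i≺j i≡j)
  ... | no  i≢j | yes xy  = yes (i≢j , xy)
  ... | no  _   | no  ¬xy = no (¬xy ∘ proj₂)

  ≺-irrefl : ∀ i → ¬ i ≺ i
  ≺-irrefl i i≺i = proj₁ i≺i refl

  -- Transitivity is the pure order axiom, except that i ≺ j ≺ i is a cross.
  ≺-trans : ∀ {i j k} → i ≺ j → j ≺ k → i ≺ k
  ≺-trans {i} {j} {k} (i≢j , xᵢyⱼ) (j≢k , xⱼyₖ) with i ≟ k
  ... | yes refl = contradiction (i , j , i≢j , xᵢyⱼ , xⱼyₖ) noCross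
  ... | no  i≢k  = i≢k , transitive P i j k i≢j j≢k i≢k xᵢyⱼ xⱼyₖ

  -- Since X ∪ Y covers the vertices and X is independent, neighbours of x's
  -- are y's; dually neighbours of y's are x's.
  x-neighbour : ∀ {i v} → Adj G (x P i) v → ∃ λ k → v ≡ y P k
  x-neighbour {i} {v} adj with proj₂ (partition P) v
  ... | inj₁ k , cover with cover refl
  ...   | refl = contradiction adj (indepX P i k)
  x-neighbour {i} {v} adj | inj₂ k , cover = k , ≡-sym (cover refl)

  y-neighbour : ∀ {j v} → Adj G (y P j) v → ∃ λ k → v ≡ x P k
  y-neighbour {j} {v} adj with proj₂ (partition P) v
  ... | inj₂ k , cover with cover refl
  ...   | refl = contradiction adj (indepY P j k)
  y-neighbour {j} {v} adj | inj₁ k , cover = k , ≡-sym (cover refl)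

  maximal-x-degree-one : ∀ i → (∀ k → ¬ i ≺ k) → degree G (x P i) ≡ 1
  maximal-x-degree-one i max = degree-one G (matched P i) only
    where
    only : ∀ v → Adj G (x P i) v → v ≡ y P i
    only v adj with x-neighbour adj
    ... | k , refl with i ≟ k
    ...   | yes refl = refl
    ...   | no  i≢k  = contradiction (i≢k , adj) (max k)

  minimal-y-degree-one : ∀ j → (∀ k → ¬ k ≺ j) → degree G (y P j) ≡ 1
  minimal-y-degree-one j min = degree-one G (sym G (matched P j)) only
    where
    only : ∀ v → Adj G (y P j) v → v ≡ x P j
    only v adj with y-neighbour adj
    ... | k , refl with k ≟ j
    ...   | yes refl = refl
    ...   | no  k≢j  = contradiction (k≢j , sym G adj) (min k)

  open MaximalElement _≺_ _≺?_ ≺-irrefl ≺-trans public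
    using () renaming (maximal to ≺-maximal)
  open MaximalElement (λ i j → j ≺ i) (λ i j → j ≺? i) ≺-irrefl (λ p q → ≺-trans q p) public
    using () renaming (maximal to ≺-minimal)

  index-of : Fin m → Fin (n P)
  index-of v with proj₁ (proj₂ (partition P) v)
  ... | inj₁ k = k
  ... | inj₂ k = k

lemma4p7 : ∀ {m : ℕ} (G : SimpleGraph m) → IsBipartite G → CrossFree G → 2 ≤ m →
           (P : PureOrder G) →
           ∃ λ i → ∃ λ j → degree G (x P i) ≡ 1 × degree G (y P j) ≡ 1
lemma4p7 G _ (_ , crossFree) (s≤s _) P =
  let open CrossFreeOrder G P (crossFree P)
      i , max = ≺-maximal (allFin (n P)) ∈-allFin (index-of zero)
      j , min = ≺-minimal (allFin (n P)) ∈-allFin (index-of zero)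
  in i , j , maximal-x-degree-one i max , minimal-y-degree-one j min
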